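{- Let $A$ be an integral domain and $f\in A$ such that $R=A/fA$ is a finite ring of characteristic $n$. Suppose $R$ is a symmetric $\mathbb{Z}/n$-algebra. Then for every $g\in A$ with $g\mid f$, the ring $A/gA$ is a symmetric $\mathbb{Z}/n$-algebra.
   Context: A finite $\mathbb{Z}/n$-algebra is a finite ring $R$ with $n\cdot1_R=0$. It is symmetric if there exists an additive homomorphism $\psi\colon R\to\mathbb{Z}/n$ whose kernel contains no non-zero ideal of $R$. -}

module Defs where

open import Level using (Level; _⊔_; suc)
open import Algebra.Bundles using (CommutativeRing)
open import Data.Nat as ℕ using (ℕ; zero; _<_)
open import Data.Integer as ℤ using (ℤ; +_)
open import Data.Integer.Divisibility as ℤD using ()
open import Data.Fin using (Fin)
open import Data.Product using (Σ; ∃; _×_; _,_)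
open import Data.Sum using (_⊎_)
open import Relation.Nullary using (¬_)
open import Relation.Binary.PropositionalEquality using (_≡_)

module _ {c ℓ : Level} (A : CommutativeRing c ℓ) where
  open CommutativeRing A

  IsIntegralDomain : Set (c ⊔ ℓ)
  IsIntegralDomain =
    (¬ (1# ≈ 0#)) × (∀ x y → (x * y) ≈ 0# → (x ≈ 0#) ⊎ (y ≈ 0#))

  Divides : Carrier → Carrier → Set (c ⊔ ℓ)
  Divides g f = ∃ λ q → (g * q) ≈ f

  -- Congruence modulo the principal ideal gA; this is equality in A/gA.
  _≈[_]_ : Carrier → Carrier → Carrier → Set (c ⊔ ℓ)
  x ≈[ g ] y = ∃ λ q → (x - y) ≈ (g * q)

  _·_ : ℕ → Carrier → Carrier
  zero · x = 0#
  ℕ.suc k · x = x + (k · x)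

  -- A/gA is finite: it is in bijection with Fin m for some m
  -- (h is a well-defined, injective, surjective map A/gA → Fin m).
  QuotientFinite : Carrier → Set (c ⊔ ℓ)
  QuotientFinite g = ∃ λ (m : ℕ) → Σ (Carrier → Fin m) λ h →
      (∀ x y → x ≈[ g ] y → h x ≡ h y)
    × (∀ x y → h x ≡ h y → x ≈[ g ] y)
    × (∀ i → ∃ λ x → h x ≡ i)

  HasCharacteristic : Carrier → ℕ → Set (c ⊔ ℓ)
  HasCharacteristic g n =
    (0 < n) × ((n · 1#) ≈[ g ] 0#) × (∀ k → 0 < k → k < n → ¬ ((k · 1#) ≈[ g ] 0#))

  -- An ideal of A/gA, given as a predicate on representatives in A that
  -- respects congruence mod g, contains 0, and is closed under + and A-multiples.
  record IsQuotientIdeal (g : Carrier) (I : Carrier → Set (c ⊔ ℓ)) : Set (c ⊔ ℓ) where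
    field
      respects : ∀ x y → x ≈[ g ] y → I x → I y
      has-0    : I 0#
      +-closed : ∀ x y → I x → I y → I (x + y)
      *-closed : ∀ r x → I x → I (r * x)

  -- Z/n is modelled as ℤ with equality "congruent mod n".
  _≡ℤ[_]_ : ℤ → ℕ → ℤ → Set
  a ≡ℤ[ n ] b = (+ n) ℤD.∣ (a ℤ.- b)

  -- ψ : A/gA → Z/n is a well-defined additive homomorphism whose kernel
  -- contains no non-zero ideal of A/gA.
  IsSymmetricForm : Carrier → ℕ → (Carrier → ℤ) → Set (suc (c ⊔ ℓ))
  IsSymmetricForm g n ψ =
      (∀ x y → x ≈[ g ] y → ψ x ≡ℤ[ n ] ψ y)
    × (∀ x y → ψ (x + y) ≡ℤ[ n ] (ψ x ℤ.+ ψ y))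
    × (∀ (I : Carrier → Set (c ⊔ ℓ)) → IsQuotientIdeal g I →
         (∀ x → I x → ψ x ≡ℤ[ n ] (+ 0)) → ∀ x → I x → x ≈[ g ] 0#)

  IsSymmetricZnAlgebra : Carrier → ℕ → Set (suc (c ⊔ ℓ))
  IsSymmetricZnAlgebra g n =
      QuotientFinite g
    × ((n · 1#) ≈[ g ] 0#)
    × (∃ λ (ψ : Carrier → ℤ) → IsSymmetricForm g n ψ)

{-# OPTIONS --safe #-}
module Submission where

-- Write f = g q. Multiplication by q maps A/gA into A/fA, injectively when q ≠ 0
-- since A is a domain, so a symmetric form ψ on A/fA pulls back to x ↦ ψ (q x):
-- if it vanishes on an ideal I of A/gA, then ψ vanishes on the ideal qI + fA,
-- whence qI ⊆ fA = q g A and I ⊆ gA. A/gA is finite as a quotient of A/fA.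
-- Equality in A is not decidable but membership in fA is, so split on q ∈ fA:
-- there q = f s gives f (1 - g s) = 0, so either g is a unit (A/gA = 0 and any
-- form is symmetric) or f = 0. In the latter case A is a finite domain, hence a
-- field, and g is a unit or g = 0 = f, where q = 1 can be used instead.

open import Defs hiding (_≈[_]_; _≡ℤ[_]_)
import Defs
open import Level using (Level; _⊔_)
open import Algebra.Bundles using (CommutativeRing; Group; AbelianGroup)
open import Data.Nat using (ℕ; zero; suc)
open import Data.Nat.Properties using (n<1+n)
open import Data.Fin using (Fin; zero; suc)
open import Data.Fin.Properties using (any?; pigeonhole; suc-injective; <-irrefl; _≟_)
open import Data.Integer as ℤ using (ℤ; +_)
open import Data.Integer.Properties using (+-0-abelianGroup)
open import Data.Integer.Divisibility using (_∣_)
open import Data.Nat.Divisibility using (_∣0)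
open import Data.Integer.Divisibility.Signed using (∣⇒∣ᵤ; ∣ᵤ⇒∣; ∣m∣n⇒∣m+n)
open import Data.Product using (Σ; ∃; ∃₂; _×_; _,_; proj₁; proj₂)
open import Data.Sum as Sum using (_⊎_; inj₁; inj₂)
open import Data.Empty using (⊥-elim)
open import Function using (_∘_)
open import Function.Definitions using (Injective)
open import Relation.Nullary using (¬_; yes; no; contradiction)
open import Relation.Nullary.Decidable using (map′)
open import Relation.Binary.Core using (Rel; _⇒_)
open import Relation.Binary.Definitions using (Decidable)
open import Relation.Binary.Structures using (IsEquivalence; IsDecEquivalence)
import Relation.Binary.Construct.On as On
open import Relation.Binary.PropositionalEquality as ≡ using (_≡_; cong; subst)

FiniteQuotient : ∀ {a ℓ} {X : Set a} → Rel X ℓ → Set (a ⊔ ℓ)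
FiniteQuotient {X = X} _~_ = ∃ λ m → Σ (X → Fin m) λ h →
    (∀ x y → x ~ y → h x ≡ h y)
  × (∀ x y → h x ≡ h y → x ~ y)
  × (∀ i → ∃ λ x → h x ≡ i)

module FiniteQuotientProperties
  {a ℓ} {X : Set a} {_~_ : Rel X ℓ} (fq : FiniteQuotient _~_) where

  size : ℕ
  size = proj₁ fq

  class : X → Fin size
  class = proj₁ (proj₂ fq)

  class-resp : ∀ x y → x ~ y → class x ≡ class y
  class-resp = proj₁ (proj₂ (proj₂ fq))

  class-injective : ∀ x y → class x ≡ class y → x ~ y
  class-injective = proj₁ (proj₂ (proj₂ (proj₂ fq)))

  rep : Fin size → X
  rep i = proj₁ (proj₂ (proj₂ (proj₂ (proj₂ fq))) i)

  class-rep : ∀ i → class (rep i) ≡ i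
  class-rep i = proj₂ (proj₂ (proj₂ (proj₂ (proj₂ fq))) i)

  rep-class : ∀ x → rep (class x) ~ x
  rep-class x = class-injective _ _ (class-rep (class x))

  decidable : Decidable _~_
  decidable x y = map′ (class-injective x y) (class-resp x y) (class x ≟ class y)

  selfMap-hits⊎collides : (φ : X → X) → ∀ z →
    (∃ λ x → φ x ~ z) ⊎ (∃₂ λ x y → ¬ x ~ y × φ x ~ φ y)
  selfMap-hits⊎collides φ z with pigeonhole (n<1+n size) F
    where
    F : Fin (suc size) → Fin size
    F zero    = class z
    F (suc i) = class (φ (rep i))
  ... | zero  , suc j , _   , z≡φj = inj₁ (rep j , class-injective _ _ (≡.sym z≡φj))
  ... | suc i , suc j , i<j , φi≡φj =
    inj₂ (rep i , rep j , rep-distinct , class-injective _ _ φi≡φj)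
    where
    rep-distinct : ¬ rep i ~ rep j
    rep-distinct i~j = <-irrefl (cong suc i≡j) i<j
      where
      i≡j : i ≡ j
      i≡j = ≡.trans (≡.sym (class-rep i)) (≡.trans (class-resp _ _ i~j) (class-rep j))

-- The element zero either joins the class of some suc j₀ or forms a new class.
finiteQuotient-Fin : ∀ {m ℓ} {R : Rel (Fin m) ℓ} → IsDecEquivalence R → FiniteQuotient R
finiteQuotient-Fin {zero}  _ = zero , (λ ()) , (λ ()) , (λ ()) , (λ ())
finiteQuotient-Fin {suc m} {R = R} isDecEq
  with finiteQuotient-Fin (On.isDecEquivalence suc isDecEq)
     | any? (λ j → IsDecEquivalence._≟_ isDecEq zero (suc j))
... | m′ , h , h-resp , h-inj , h-surj | yes (j₀ , R0j₀) =
  m′ , k , k-resp , k-inj , k-surj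
  where
  module R = IsDecEquivalence isDecEq
  k : Fin (suc m) → Fin m′
  k zero    = h j₀
  k (suc i) = h i
  k-resp : ∀ i j → R i j → k i ≡ k j
  k-resp zero    zero    _   = ≡.refl
  k-resp zero    (suc j) R0j = h-resp j₀ j (R.trans (R.sym R0j₀) R0j)
  k-resp (suc i) zero    Ri0 = h-resp i j₀ (R.trans Ri0 R0j₀)
  k-resp (suc i) (suc j) Rij = h-resp i j Rij
  k-inj : ∀ i j → k i ≡ k j → R i j
  k-inj zero    zero    _ = R.refl
  k-inj zero    (suc j) e = R.trans R0j₀ (h-inj j₀ j e)
  k-inj (suc i) zero    e = R.trans (h-inj i j₀ e) (R.sym R0j₀)
  k-inj (suc i) (suc j) e = h-inj i j e
  k-surj : ∀ i → ∃ λ j → k j ≡ i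
  k-surj i = suc (proj₁ (h-surj i)) , proj₂ (h-surj i)
... | m′ , h , h-resp , h-inj , h-surj | no ¬R0 =
  suc m′ , k , k-resp , k-inj , k-surj
  where
  module R = IsDecEquivalence isDecEq
  k : Fin (suc m) → Fin (suc m′)
  k zero    = zero
  k (suc i) = suc (h i)
  k-resp : ∀ i j → R i j → k i ≡ k j
  k-resp zero    zero    _   = ≡.refl
  k-resp zero    (suc j) R0j = contradiction (j , R0j) ¬R0
  k-resp (suc i) zero    Ri0 = contradiction (i , R.sym Ri0) ¬R0
  k-resp (suc i) (suc j) Rij = cong suc (h-resp i j Rij)
  k-inj : ∀ i j → k i ≡ k j → R i j
  k-inj zero    zero    _ = R.refl
  k-inj (suc i) (suc j) e = h-inj i j (suc-injective e)
  k-surj : ∀ i → ∃ λ j → k j ≡ i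
  k-surj zero    = zero , ≡.refl
  k-surj (suc i) = suc (proj₁ (h-surj i)) , cong suc (proj₂ (h-surj i))

finiteQuotient-coarsen : ∀ {a ℓ₁ ℓ₂} {X : Set a} {_~_ : Rel X ℓ₁} {_≋_ : Rel X ℓ₂} →
  FiniteQuotient _~_ → _~_ ⇒ _≋_ → IsDecEquivalence _≋_ → FiniteQuotient _≋_
finiteQuotient-coarsen {_~_ = _~_} {_≋_} fq ~⇒≋ isDecEq
  with finiteQuotient-Fin (On.isDecEquivalence rep isDecEq)
  where open FiniteQuotientProperties fq
... | m′ , k , k-resp , k-inj , k-surj =
  m′ , k ∘ class , resp , inj , surj
  where
  open FiniteQuotientProperties fq
  open IsDecEquivalence isDecEq using (sym; trans)
  resp : ∀ x y → x ≋ y → k (class x) ≡ k (class y)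
  resp x y x≋y = k-resp _ _ (trans (~⇒≋ (rep-class x)) (trans x≋y (sym (~⇒≋ (rep-class y)))))
  inj : ∀ x y → k (class x) ≡ k (class y) → x ≋ y
  inj x y e = trans (sym (~⇒≋ (rep-class x))) (trans (k-inj _ _ e) (~⇒≋ (rep-class y)))
  surj : ∀ i → ∃ λ x → k (class x) ≡ i
  surj i = rep (proj₁ (k-surj i)) , ≡.trans (cong k (class-rep _)) (proj₂ (k-surj i))

module _ {a ℓ} (G : Group a ℓ) where
  open Group G
  open import Relation.Binary.Reasoning.Setoid setoid

  xy⁻¹∙yz⁻¹≈xz⁻¹ : ∀ x y z → (x ∙ y ⁻¹) ∙ (y ∙ z ⁻¹) ≈ x ∙ z ⁻¹
  xy⁻¹∙yz⁻¹≈xz⁻¹ x y z = begin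
    (x ∙ y ⁻¹) ∙ (y ∙ z ⁻¹) ≈⟨ assoc x (y ⁻¹) (y ∙ z ⁻¹) ⟩
    x ∙ (y ⁻¹ ∙ (y ∙ z ⁻¹)) ≈⟨ ∙-congˡ (assoc (y ⁻¹) y (z ⁻¹)) ⟨
    x ∙ ((y ⁻¹ ∙ y) ∙ z ⁻¹) ≈⟨ ∙-congˡ (∙-congʳ (inverseˡ y)) ⟩
    x ∙ (ε ∙ z ⁻¹)          ≈⟨ ∙-congˡ (identityˡ (z ⁻¹)) ⟩
    x ∙ z ⁻¹                ∎

module _ {c ℓ} (A : CommutativeRing c ℓ) where
  open CommutativeRing A
  open import Relation.Binary.Reasoning.Setoid setoid
  open import Algebra.Properties.Ring ring using (x[y-z]≈xy-xz; -‿distribʳ-*)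
  open import Algebra.Properties.Group +-group using (x∙y⁻¹≈ε⇒x≈y; x≈y⇒x∙y⁻¹≈ε; ε⁻¹≈ε)
  open import Algebra.Properties.AbelianGroup +-abelianGroup using (⁻¹-anti-homo‿-; ⁻¹-∙-comm)
  open import Algebra.Properties.CommutativeSemigroup +-commutativeSemigroup using (interchange)
  open import Algebra.Properties.CommutativeSemigroup *-commutativeSemigroup using (x∙yz≈y∙xz; x∙yz≈yx∙z)

  infix 4 _≈[_]_ _≡ℤ[_]_

  _≈[_]_ : Carrier → Carrier → Carrier → Set (c ⊔ ℓ)
  _≈[_]_ = Defs._≈[_]_ A

  _≡ℤ[_]_ : ℤ → ℕ → ℤ → Set
  _≡ℤ[_]_ = Defs._≡ℤ[_]_ A

  -- The relation unfolds to divisibility of absolute values, so i, j, k cannot be inferred.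
  ≡ℤ[]-trans : ∀ {n} i j k → i ≡ℤ[ n ] j → j ≡ℤ[ n ] k → i ≡ℤ[ n ] k
  ≡ℤ[]-trans {n} i j k n∣i-j n∣j-k =
    subst (+ n ∣_) (xy⁻¹∙yz⁻¹≈xz⁻¹ (AbelianGroup.group +-0-abelianGroup) i j k)
      (∣⇒∣ᵤ {+ n} {(i ℤ.- j) ℤ.+ (j ℤ.- k)}
        (∣m∣n⇒∣m+n (∣ᵤ⇒∣ {+ n} {i ℤ.- j} n∣i-j) (∣ᵤ⇒∣ {+ n} {j ℤ.- k} n∣j-k)))

  x-0≈x : ∀ x → x - 0# ≈ x
  x-0≈x x = trans (+-congˡ ε⁻¹≈ε) (+-identityʳ x)

  ≈⇒≈[] : ∀ {g x y} → x ≈ y → x ≈[ g ] y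
  ≈⇒≈[] {g} x≈y = 0# , trans (x≈y⇒x∙y⁻¹≈ε x≈y) (sym (zeroʳ g))

  ≈[]-refl : ∀ {g x} → x ≈[ g ] x
  ≈[]-refl = ≈⇒≈[] refl

  ≈[]-sym : ∀ {g x y} → x ≈[ g ] y → y ≈[ g ] x
  ≈[]-sym {g} {x} {y} (q , x-y≈gq) = - q , (begin
    y - x     ≈⟨ ⁻¹-anti-homo‿- x y ⟨
    - (x - y) ≈⟨ -‿cong x-y≈gq ⟩
    - (g * q) ≈⟨ -‿distribʳ-* g q ⟩
    g * - q   ∎)

  ≈[]-trans : ∀ {g x y z} → x ≈[ g ] y → y ≈[ g ] z → x ≈[ g ] z
  ≈[]-trans {g} {x} {y} {z} (q , x-y≈gq) (r , y-z≈gr) = q + r , (begin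
    x - z             ≈⟨ xy⁻¹∙yz⁻¹≈xz⁻¹ +-group x y z ⟨
    (x - y) + (y - z) ≈⟨ +-cong x-y≈gq y-z≈gr ⟩
    g * q + g * r     ≈⟨ distribˡ g q r ⟨
    g * (q + r)       ∎)

  ≈[]-isEquivalence : ∀ g → IsEquivalence (_≈[ g ]_)
  ≈[]-isEquivalence g = record { refl = ≈[]-refl ; sym = ≈[]-sym ; trans = ≈[]-trans }

  ≈[]-+-cong : ∀ {g x₁ x₂ y₁ y₂} → x₁ ≈[ g ] y₁ → x₂ ≈[ g ] y₂ → x₁ + x₂ ≈[ g ] y₁ + y₂
  ≈[]-+-cong {g} {x₁} {x₂} {y₁} {y₂} (q , e₁) (r , e₂) = q + r , (begin
    (x₁ + x₂) - (y₁ + y₂)     ≈⟨ +-congˡ (⁻¹-∙-comm y₁ y₂) ⟨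
    (x₁ + x₂) + (- y₁ + - y₂) ≈⟨ interchange x₁ x₂ (- y₁) (- y₂) ⟩
    (x₁ - y₁) + (x₂ - y₂)     ≈⟨ +-cong e₁ e₂ ⟩
    g * q + g * r             ≈⟨ distribˡ g q r ⟨
    g * (q + r)               ∎)

  ≈[]-*-congˡ : ∀ {g r x y} → x ≈[ g ] y → r * x ≈[ g ] r * y
  ≈[]-*-congˡ {g} {r} {x} {y} (q , x-y≈gq) = r * q , (begin
    r * x - r * y ≈⟨ x[y-z]≈xy-xz r x y ⟨
    r * (x - y)   ≈⟨ *-congˡ x-y≈gq ⟩
    r * (g * q)   ≈⟨ x∙yz≈y∙xz r g q ⟩
    g * (r * q)   ∎)

  x-y≈[]0⇒x≈[]y : ∀ {g x y} → x - y ≈[ g ] 0# → x ≈[ g ] y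
  x-y≈[]0⇒x≈[]y {x = x} {y} (q , e) = q , trans (sym (x-0≈x (x - y))) e

  ≈[]-multiple : ∀ g r → g * r ≈[ g ] 0#
  ≈[]-multiple g r = r , x-0≈x (g * r)

  ≈[]-divisor : ∀ {f g x y} → Divides A g f → x ≈[ f ] y → x ≈[ g ] y
  ≈[]-divisor {f} {g} {x} {y} (q , gq≈f) (t , x-y≈ft) = q * t , (begin
    x - y       ≈⟨ x-y≈ft ⟩
    f * t       ≈⟨ *-congʳ gq≈f ⟨
    (g * q) * t ≈⟨ *-assoc g q t ⟩
    g * (q * t) ∎)

  ≈[]-unit : ∀ {g} → Divides A g 1# → ∀ x y → x ≈[ g ] y
  ≈[]-unit {g} (s , gs≈1) x y = s * (x - y) , (begin
    x - y             ≈⟨ *-identityˡ (x - y) ⟨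
    1# * (x - y)      ≈⟨ *-congʳ gs≈1 ⟨
    (g * s) * (x - y) ≈⟨ *-assoc g s (x - y) ⟩
    g * (s * (x - y)) ∎)

  ≈[]-*-scale : ∀ {f g q x y} → g * q ≈ f → x ≈[ g ] y → q * x ≈[ f ] q * y
  ≈[]-*-scale {f} {g} {q} {x} {y} gq≈f (t , x-y≈gt) = t , (begin
    q * x - q * y ≈⟨ x[y-z]≈xy-xz q x y ⟨
    q * (x - y)   ≈⟨ *-congˡ x-y≈gt ⟩
    q * (g * t)   ≈⟨ x∙yz≈yx∙z q g t ⟩
    (g * q) * t   ≈⟨ *-congʳ gq≈f ⟩
    f * t         ∎)

  ≈[]-*-cancel : ∀ {f g q x y} → Injective _≈_ _≈_ (q *_) → g * q ≈ f →
    q * x ≈[ f ] q * y → x ≈[ g ] y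
  ≈[]-*-cancel {f} {g} {q} {x} {y} q-injective gq≈f (t , qx-qy≈ft) = t , q-injective (begin
    q * (x - y)   ≈⟨ x[y-z]≈xy-xz q x y ⟩
    q * x - q * y ≈⟨ qx-qy≈ft ⟩
    f * t         ≈⟨ *-congʳ gq≈f ⟨
    (g * q) * t   ≈⟨ x∙yz≈yx∙z q g t ⟨
    q * (g * t)   ∎)

  ≈[0]⇒≈ : ∀ {f x y} → f ≈ 0# → x ≈[ f ] y → x ≈ y
  ≈[0]⇒≈ {f} {x} {y} f≈0 (t , x-y≈ft) = x∙y⁻¹≈ε⇒x≈y x y (begin
    x - y  ≈⟨ x-y≈ft ⟩
    f * t  ≈⟨ *-congʳ f≈0 ⟩
    0# * t ≈⟨ zeroˡ t ⟩
    0#     ∎)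

  domain-*-zero⊎cancel : IsIntegralDomain A → ∀ {q x y} → q * x ≈ q * y → q ≈ 0# ⊎ x ≈ y
  domain-*-zero⊎cancel (_ , noZeroDivisors) {q} {x} {y} qx≈qy =
    Sum.map₂ (x∙y⁻¹≈ε⇒x≈y x y)
      (noZeroDivisors q (x - y) (trans (x[y-z]≈xy-xz q x y) (x≈y⇒x∙y⁻¹≈ε qx≈qy)))

  domain-*-injective : IsIntegralDomain A → ∀ {q} → ¬ q ≈ 0# → Injective _≈_ _≈_ (q *_)
  domain-*-injective dom q≉0 qx≈qy = Sum.fromInj₂ (⊥-elim ∘ q≉0) (domain-*-zero⊎cancel dom qx≈qy)

  module _ {f g} (finF : QuotientFinite A f) (g∣f : Divides A g f) where
    open FiniteQuotientProperties finF

    ≈[]-divisor-decidable : Decidable (_≈[ g ]_)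
    ≈[]-divisor-decidable x y =
      map′ from to (any? λ i → decidable (x - y) (g * rep i))
      where
      from : (∃ λ i → x - y ≈[ f ] g * rep i) → x ≈[ g ] y
      from (i , e) = x-y≈[]0⇒x≈[]y (≈[]-trans (≈[]-divisor g∣f e) (≈[]-multiple g (rep i)))
      to : x ≈[ g ] y → ∃ λ i → x - y ≈[ f ] g * rep i
      to (t , x-y≈gt) = class t , ≈[]-trans (≈⇒≈[] x-y≈gt) (≈[]-*-congˡ (≈[]-sym (rep-class t)))

    quotientFinite-divisor : QuotientFinite A g
    quotientFinite-divisor = finiteQuotient-coarsen finF (≈[]-divisor g∣f) record
      { isEquivalence = ≈[]-isEquivalence g
      ; _≟_           = ≈[]-divisor-decidable
      }

  finiteDomain-unit⊎zero : IsIntegralDomain A → ∀ {f} → QuotientFinite A f → f ≈ 0# →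
    ∀ g → Divides A g 1# ⊎ g ≈ 0#
  finiteDomain-unit⊎zero dom finF f≈0 g
    with FiniteQuotientProperties.selfMap-hits⊎collides finF (g *_) 1#
  ... | inj₁ (s , gs≈1) = inj₁ (s , ≈[0]⇒≈ f≈0 gs≈1)
  ... | inj₂ (x , y , x≉y , gx≈gy) with domain-*-zero⊎cancel dom (≈[0]⇒≈ f≈0 gx≈gy)
  ...   | inj₁ g≈0 = inj₂ g≈0
  ...   | inj₂ x≈y = contradiction (≈⇒≈[] x≈y) x≉y

  cofactor-multiple⇒zero⊎unit : IsIntegralDomain A → ∀ {f g q} → g * q ≈ f → q ≈[ f ] 0# →
    f ≈ 0# ⊎ Divides A g 1#
  cofactor-multiple⇒zero⊎unit dom {f} {g} {q} gq≈f (s , q-0≈fs) =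
    Sum.map₂ (λ 1≈gs → s , sym 1≈gs) (domain-*-zero⊎cancel dom f1≈fgs)
    where
    f1≈fgs : f * 1# ≈ f * (g * s)
    f1≈fgs = begin
      f * 1#      ≈⟨ *-identityʳ f ⟩
      f           ≈⟨ gq≈f ⟨
      g * q       ≈⟨ *-congˡ (trans (sym (x-0≈x q)) q-0≈fs) ⟩
      g * (f * s) ≈⟨ x∙yz≈y∙xz g f s ⟩
      f * (g * s) ∎

  imageIdeal : Carrier → Carrier → (Carrier → Set (c ⊔ ℓ)) → Carrier → Set (c ⊔ ℓ)
  imageIdeal f q I y = ∃ λ x → I x × y ≈[ f ] q * x

  imageIdeal-isQuotientIdeal : ∀ {g} f q {I} → IsQuotientIdeal A g I →
    IsQuotientIdeal A f (imageIdeal f q I)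
  imageIdeal-isQuotientIdeal f q isIdeal = record
    { respects = λ { y y′ y≈y′ (x , Ix , y≈qx) → x , Ix , ≈[]-trans (≈[]-sym y≈y′) y≈qx }
    ; has-0    = 0# , has-0 , ≈⇒≈[] (sym (zeroʳ q))
    ; +-closed = λ { y₁ y₂ (x₁ , Ix₁ , y₁≈qx₁) (x₂ , Ix₂ , y₂≈qx₂) →
        x₁ + x₂ , +-closed x₁ x₂ Ix₁ Ix₂ ,
        ≈[]-trans (≈[]-+-cong y₁≈qx₁ y₂≈qx₂) (≈⇒≈[] (sym (distribˡ q x₁ x₂))) }
    ; *-closed = λ { r y (x , Ix , y≈qx) →
        r * x , *-closed r x Ix ,
        ≈[]-trans (≈[]-*-congˡ y≈qx) (≈⇒≈[] (x∙yz≈y∙xz r q x)) }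
    }
    where open IsQuotientIdeal isIdeal

  isSymmetricForm-pullback : ∀ {f g q n} ψ → Injective _≈_ _≈_ (q *_) → g * q ≈ f →
    IsSymmetricForm A f n ψ → IsSymmetricForm A g n (ψ ∘ (q *_))
  isSymmetricForm-pullback {f} {g} {q} {n} ψ q-injective gq≈f (ψ-resp , ψ-+ , ψ-nondegenerate) =
    (λ x y → ψ-resp (q * x) (q * y) ∘ ≈[]-*-scale gq≈f) ,
    (λ x y → ≡ℤ[]-trans (ψ (q * (x + y))) (ψ (q * x + q * y)) (ψ (q * x) ℤ.+ ψ (q * y))
      (ψ-resp _ _ (≈⇒≈[] (distribˡ q x y))) (ψ-+ (q * x) (q * y))) ,
    nondegenerate
    where
    nondegenerate : ∀ I → IsQuotientIdeal A g I → (∀ x → I x → ψ (q * x) ≡ℤ[ n ] + 0) →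
      ∀ x → I x → x ≈[ g ] 0#
    nondegenerate I isIdeal ψqI≡0 x Ix =
      ≈[]-*-cancel q-injective gq≈f (≈[]-trans qx≈0 (≈⇒≈[] (sym (zeroʳ q))))
      where
      ψ-kills-qI : ∀ y → imageIdeal f q I y → ψ y ≡ℤ[ n ] + 0
      ψ-kills-qI y (x , Ix , y≈qx) =
        ≡ℤ[]-trans (ψ y) (ψ (q * x)) (+ 0) (ψ-resp _ _ y≈qx) (ψqI≡0 x Ix)
      qx≈0 : q * x ≈[ f ] 0#
      qx≈0 = ψ-nondegenerate (imageIdeal f q I) (imageIdeal-isQuotientIdeal f q isIdeal)
        ψ-kills-qI (q * x) (x , Ix , ≈[]-refl)

  isSymmetricForm-unit : ∀ {g n} → Divides A g 1# → IsSymmetricForm A g n (λ _ → + 0)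
  isSymmetricForm-unit {n = n} g-unit =
    (λ _ _ _ → n ∣0) , (λ _ _ → n ∣0) , (λ _ _ _ x _ → ≈[]-unit g-unit x 0#)

  isSymmetricForm-divisor : IsIntegralDomain A → ∀ {f g n} → QuotientFinite A f → Divides A g f →
    ∀ ψ → IsSymmetricForm A f n ψ → ∃ λ φ → IsSymmetricForm A g n φ
  isSymmetricForm-divisor dom {f} {g} finF (q , gq≈f) ψ ψ-symmetric
    with FiniteQuotientProperties.decidable finF q 0#
  ... | no q∉fA = ψ ∘ (q *_) ,
    isSymmetricForm-pullback ψ (domain-*-injective dom (q∉fA ∘ ≈⇒≈[])) gq≈f ψ-symmetric
  ... | yes q∈fA with cofactor-multiple⇒zero⊎unit dom gq≈f q∈fA
  ...   | inj₂ g-unit = (λ _ → + 0) , isSymmetricForm-unit g-unit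
  ...   | inj₁ f≈0 with finiteDomain-unit⊎zero dom finF f≈0 g
  ...     | inj₁ g-unit = (λ _ → + 0) , isSymmetricForm-unit g-unit
  ...     | inj₂ g≈0 = ψ ∘ (1# *_) ,
    isSymmetricForm-pullback ψ (domain-*-injective dom (proj₁ dom)) g1≈f ψ-symmetric
    where
    g1≈f : g * 1# ≈ f
    g1≈f = trans (*-identityʳ g) (trans g≈0 (sym f≈0))

proposition3p5 : {c ℓ : Level} (A : CommutativeRing c ℓ) →
    IsIntegralDomain A →
    (f : CommutativeRing.Carrier A) (n : ℕ) →
    QuotientFinite A f →
    HasCharacteristic A f n →
    IsSymmetricZnAlgebra A f n →
    (g : CommutativeRing.Carrier A) → Divides A g f →
    IsSymmetricZnAlgebra A g n
proposition3p5 A dom f n finF _ (_ , n≈0 , ψ , ψ-symmetric) g g∣f =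
    quotientFinite-divisor A finF g∣f
  , ≈[]-divisor A g∣f n≈0
  , isSymmetricForm-divisor A dom finF g∣f ψ ψ-symmetric
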